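{- Let $\mathcal{R}$ be a rewrite system on terms and $\equiv$ the congruence it generates. In asymmetric atomic deduction modulo $\mathcal{R}$, a sequent $\Gamma \vdash \Delta$ is provable if and only if there are a proposition $A$ in $\Gamma$ and a proposition $B$ in $\Delta$ such that $A \equiv B$.
   Context: Fix a first-order language. A rewrite rule is a pair of terms $\langle l, r\rangle$, written $l \rightarrow r$, where $l$ is not a variable; a rewrite system is a set of rewrite rules. The relation $\rightarrow^{1}$ is the smallest relation on terms and on propositions that is compatible with the structure of terms and propositions and such that $\theta l \rightarrow^{1} \theta r$ for every substitution $\theta$ and every rule $l \rightarrow r$. $\rightarrow^{*}$ is its reflexive-transitive closure, $\leftarrow^{*}$ the converse of $\rightarrow^{*}$, and $\equiv$ its reflexive-symmetric-transitive closure. Sequents $\Gamma \vdash \Delta$ have finite multisets $\Gamma,\Delta$ of propositions. Asymmetric atomic deduction modulo $\mathcal{R}$ is the proof system in which all propositions are atomic and whose only rules are: Axiom: $\Gamma, A_1 \vdash A_2, \Delta$ with no premise, provided there is $A$ with $A_1 \rightarrow^{*} A \leftarrow^{*} A_2$; Cut: from $\Gamma \vdash C_1, \Delta$ and $\Gamma, C_2 \vdash \Delta$ infer $\Gamma \vdash \Delta$, provided there is $C$ with $C_1 \leftarrow^{*} C \rightarrow^{*} C_2$; contraction-left: from $\Gamma, A_1, A_2 \vdash \Delta$ infer $\Gamma, A \vdash \Delta$ provided $A_1 \leftarrow^{*} A \rightarrow^{*} A_2$; contraction-right: from $\Gamma \vdash A_1, A_2, \Delta$ infer $\Gamma \vdash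 A, \Delta$ provided $A_1 \leftarrow^{*} A \rightarrow^{*} A_2$; weakening-left: from $\Gamma \vdash \Delta$ infer $\Gamma, A \vdash \Delta$; weakening-right: from $\Gamma \vdash \Delta$ infer $\Gamma \vdash A, \Delta$. -}

module Defs where

open import Data.Nat using (ℕ)
open import Data.Vec using (Vec; []; _∷_)
open import Data.List using (List; _∷_)
open import Data.List.Relation.Binary.Permutation.Propositional using (_↭_)
open import Data.Product using (Σ; _×_; ∃)
open import Relation.Binary.PropositionalEquality using (_≢_)
open import Relation.Binary.Construct.Closure.ReflexiveTransitive using (Star)
open import Relation.Binary.Construct.Closure.Equivalence using (EqClosure)

record Signature : Set₁ where
  field
    Fun    : Set
    farity : Fun → ℕ
    Pred   : Set
    parity : Pred → ℕ

module Language (S : Signature) where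
  open Signature S

  data Term : Set where
    var : ℕ → Term
    fun : (f : Fun) → Vec Term (farity f) → Term

  data Prop : Set where
    atom : (P : Pred) → Vec Term (parity P) → Prop

  Subst : Set
  Subst = ℕ → Term

  mutual
    subst : Subst → Term → Term
    subst θ (var x)    = θ x
    subst θ (fun f ts) = fun f (substs θ ts)

    substs : ∀ {n} → Subst → Vec Term n → Vec Term n
    substs θ []       = []
    substs θ (t ∷ ts) = subst θ t ∷ substs θ ts

  record Rule : Set where
    constructor _⟶_[_]
    field
      lhs    : Term
      rhs    : Term
      nonvar : ∀ x → lhs ≢ var x

  RewriteSystem : Set₁
  RewriteSystem = Rule → Set

module Rewriting {S : Signature} (R : Language.RewriteSystem S) where
  open Signature S
  open Language S
  open Rule

  mutual
    data _⟶¹_ : Term → Term → Set where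
      root : ∀ {ρ} → R ρ → (θ : Subst) → subst θ (lhs ρ) ⟶¹ subst θ (rhs ρ)
      cong-fun : ∀ {f} {ts us : Vec Term (farity f)} → ts ⟶¹ᵛ us → fun f ts ⟶¹ fun f us

    data _⟶¹ᵛ_ : ∀ {n} → Vec Term n → Vec Term n → Set where
      here  : ∀ {n t u} {ts : Vec Term n} → t ⟶¹ u → (t ∷ ts) ⟶¹ᵛ (u ∷ ts)
      there : ∀ {n t} {ts us : Vec Term n} → ts ⟶¹ᵛ us → (t ∷ ts) ⟶¹ᵛ (t ∷ us)

  data _⟶¹ᵖ_ : Prop → Prop → Set where
    cong-atom : ∀ {P} {ts us : Vec Term (parity P)} → ts ⟶¹ᵛ us → atom P ts ⟶¹ᵖ atom P us

  _⟶*_ : Prop → Prop → Set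
  _⟶*_ = Star _⟶¹ᵖ_

  _≡R_ : Prop → Prop → Set
  _≡R_ = EqClosure _⟶¹ᵖ_

  -- Sequents Γ ⊢ Δ over finite multisets, represented by lists taken up to
  -- permutation: each rule's conclusion may be any permutation of the shape.
  data _⊢_ : List Prop → List Prop → Set where
    axiom : ∀ {Γ' Δ' Γ Δ A₁ A₂} →
            Γ' ↭ (A₁ ∷ Γ) → Δ' ↭ (A₂ ∷ Δ) →
            (∃ λ A → (A₁ ⟶* A) × (A₂ ⟶* A)) →
            Γ' ⊢ Δ'
    cut : ∀ {Γ Δ C₁ C₂} →
          (∃ λ C → (C ⟶* C₁) × (C ⟶* C₂)) →
          Γ ⊢ (C₁ ∷ Δ) → (C₂ ∷ Γ) ⊢ Δ →
          Γ ⊢ Δ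
    contr-left : ∀ {Γ' Γ Δ A A₁ A₂} →
          Γ' ↭ (A ∷ Γ) → (A ⟶* A₁) → (A ⟶* A₂) →
          (A₁ ∷ A₂ ∷ Γ) ⊢ Δ →
          Γ' ⊢ Δ
    contr-right : ∀ {Γ Δ' Δ A A₁ A₂} →
          Δ' ↭ (A ∷ Δ) → (A ⟶* A₁) → (A ⟶* A₂) →
          Γ ⊢ (A₁ ∷ A₂ ∷ Δ) →
          Γ ⊢ Δ'
    weak-left : ∀ {Γ' Γ Δ A} →
          Γ' ↭ (A ∷ Γ) → Γ ⊢ Δ → Γ' ⊢ Δ
    weak-right : ∀ {Γ Δ' Δ A} →
          Δ' ↭ (A ∷ Δ) → Γ ⊢ Δ → Γ ⊢ Δ'

-- Soundness: every rule preserves the existence of a pair A ∈ Γ, B ∈ Δ with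
-- A ≡ B, since the side conditions of the rules only relate propositions that
-- are ≡-equivalent. Completeness: a chain A = C₀, C₁, …, Cₙ = B of one-step
-- rewrites and expansions is threaded through n cuts on C₁, …, Cₙ, each link
-- Cᵢ, Cᵢ₊₁ being closed by an axiom.
module Submission where

open import Defs
open import Level using (_⊔_)
open import Data.List using (List; _∷_)
open import Data.List.Membership.Propositional using (_∈_)
open import Data.List.Membership.Propositional.Properties using (∈-∃++)
open import Data.List.Relation.Unary.Any using (here; there)
open import Data.List.Relation.Binary.Permutation.Propositional using (_↭_; ↭-sym)
open import Data.List.Relation.Binary.Permutation.Propositional.Properties using (∈-resp-↭; shift)
open import Data.Product using (∃; ∃₂; _×_; _,_)
open import Function.Bundles using (_⇔_; mk⇔)
open import Relation.Binary.Bundles using (Setoid)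
open import Relation.Binary.PropositionalEquality using (refl)
open import Relation.Binary.Construct.Closure.ReflexiveTransitive as Star using (ε; _◅_)
open import Relation.Binary.Construct.Closure.Symmetric using (fwd; bwd)
import Relation.Binary.Construct.Closure.Equivalence as EqClosure

∈⇒↭-∷ : ∀ {a} {A : Set a} {x : A} {xs : List A} → x ∈ xs → ∃ λ ys → xs ↭ (x ∷ ys)
∈⇒↭-∷ {x = x} x∈xs with ys , zs , refl ← ∈-∃++ x∈xs = _ , shift x ys zs

module Linking {c ℓ} (𝒮 : Setoid c ℓ) where
  open Setoid 𝒮 using (Carrier; _≈_; sym; trans)

  Linked : List Carrier → List Carrier → Set (c ⊔ ℓ)
  Linked Γ Δ = ∃₂ λ A B → A ∈ Γ × B ∈ Δ × A ≈ B

  module _ {Γ Δ : List Carrier} where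

    linked-resp-↭ˡ : ∀ {Γ'} → Γ ↭ Γ' → Linked Γ Δ → Linked Γ' Δ
    linked-resp-↭ˡ p (A , B , A∈ , B∈ , A≈B) = A , B , ∈-resp-↭ p A∈ , B∈ , A≈B

    linked-resp-↭ʳ : ∀ {Δ'} → Δ ↭ Δ' → Linked Γ Δ → Linked Γ Δ'
    linked-resp-↭ʳ p (A , B , A∈ , B∈ , A≈B) = A , B , A∈ , ∈-resp-↭ p B∈ , A≈B

    linked-weakenˡ : ∀ {C} → Linked Γ Δ → Linked (C ∷ Γ) Δ
    linked-weakenˡ (A , B , A∈ , B∈ , A≈B) = A , B , there A∈ , B∈ , A≈B

    linked-weakenʳ : ∀ {C} → Linked Γ Δ → Linked Γ (C ∷ Δ)
    linked-weakenʳ (A , B , A∈ , B∈ , A≈B) = A , B , A∈ , there B∈ , A≈B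

    linked-contractˡ : ∀ {C C₁ C₂} → C ≈ C₁ → C ≈ C₂ →
                       Linked (C₁ ∷ C₂ ∷ Γ) Δ → Linked (C ∷ Γ) Δ
    linked-contractˡ C≈C₁ _ (_ , B , here refl , B∈ , C₁≈B) = _ , B , here refl , B∈ , trans C≈C₁ C₁≈B
    linked-contractˡ _ C≈C₂ (_ , B , there (here refl) , B∈ , C₂≈B) = _ , B , here refl , B∈ , trans C≈C₂ C₂≈B
    linked-contractˡ _ _ (A , B , there (there A∈) , B∈ , A≈B) = A , B , there A∈ , B∈ , A≈B

    linked-contractʳ : ∀ {C C₁ C₂} → C ≈ C₁ → C ≈ C₂ →
                       Linked Γ (C₁ ∷ C₂ ∷ Δ) → Linked Γ (C ∷ Δ)
    linked-contractʳ C≈C₁ _ (A , _ , A∈ , here refl , A≈C₁) = A , _ , A∈ , here refl , trans A≈C₁ (sym C≈C₁)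
    linked-contractʳ _ C≈C₂ (A , _ , A∈ , there (here refl) , A≈C₂) = A , _ , A∈ , here refl , trans A≈C₂ (sym C≈C₂)
    linked-contractʳ _ _ (A , B , A∈ , there (there B∈) , A≈B) = A , B , A∈ , there B∈ , A≈B

  linked-cut : ∀ {Γ Δ C₁ C₂} → C₁ ≈ C₂ → Linked Γ (C₁ ∷ Δ) → Linked (C₂ ∷ Γ) Δ → Linked Γ Δ
  linked-cut _ (A , B , A∈ , there B∈ , A≈B) _ = A , B , A∈ , B∈ , A≈B
  linked-cut _ (_ , _ , _ , here refl , _) (A , B , there A∈ , B∈ , A≈B) = A , B , A∈ , B∈ , A≈B
  linked-cut C₁≈C₂ (A , _ , A∈ , here refl , A≈C₁) (_ , B , here refl , B∈ , C₂≈B) =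
    A , B , A∈ , B∈ , trans A≈C₁ (trans C₁≈C₂ C₂≈B)

module _ {S : Signature} (R : Language.RewriteSystem S) where
  open Language S
  open Rewriting R
  open Linking (EqClosure.setoid _⟶¹ᵖ_)
  open Setoid (EqClosure.setoid _⟶¹ᵖ_) using (sym; trans)

  ⟶*⇒≡R : ∀ {A B} → A ⟶* B → A ≡R B
  ⟶*⇒≡R = Star.map fwd

  joinable⇒≡R : ∀ {A B C} → A ⟶* C → B ⟶* C → A ≡R B
  joinable⇒≡R A⟶*C B⟶*C = trans (⟶*⇒≡R A⟶*C) (sym (⟶*⇒≡R B⟶*C))

  ⊢⇒linked : ∀ {Γ Δ} → Γ ⊢ Δ → Linked Γ Δ
  ⊢⇒linked (axiom p q (_ , A₁⟶*A , A₂⟶*A)) =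
    linked-resp-↭ˡ (↭-sym p) (linked-resp-↭ʳ (↭-sym q)
      (_ , _ , here refl , here refl , joinable⇒≡R A₁⟶*A A₂⟶*A))
  ⊢⇒linked (cut (_ , C⟶*C₁ , C⟶*C₂) d₁ d₂) =
    linked-cut (trans (sym (⟶*⇒≡R C⟶*C₁)) (⟶*⇒≡R C⟶*C₂)) (⊢⇒linked d₁) (⊢⇒linked d₂)
  ⊢⇒linked (contr-left p A⟶*A₁ A⟶*A₂ d) =
    linked-resp-↭ˡ (↭-sym p) (linked-contractˡ (⟶*⇒≡R A⟶*A₁) (⟶*⇒≡R A⟶*A₂) (⊢⇒linked d))
  ⊢⇒linked (contr-right p A⟶*A₁ A⟶*A₂ d) =
    linked-resp-↭ʳ (↭-sym p) (linked-contractʳ (⟶*⇒≡R A⟶*A₁) (⟶*⇒≡R A⟶*A₂) (⊢⇒linked d))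
  ⊢⇒linked (weak-left p d) = linked-resp-↭ˡ (↭-sym p) (linked-weakenˡ (⊢⇒linked d))
  ⊢⇒linked (weak-right p d) = linked-resp-↭ʳ (↭-sym p) (linked-weakenʳ (⊢⇒linked d))

  axiom-∈ : ∀ {Γ Δ A B C} → A ∈ Γ → B ∈ Δ → A ⟶* C → B ⟶* C → Γ ⊢ Δ
  axiom-∈ A∈Γ B∈Δ A⟶*C B⟶*C with _ , p ← ∈⇒↭-∷ A∈Γ | _ , q ← ∈⇒↭-∷ B∈Δ =
    axiom p q (_ , A⟶*C , B⟶*C)

  ≡R⇒⊢ : ∀ {Γ Δ A B} → A ∈ Γ → B ∈ Δ → A ≡R B → Γ ⊢ Δ
  ≡R⇒⊢ A∈Γ B∈Δ ε = axiom-∈ A∈Γ B∈Δ ε ε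
  ≡R⇒⊢ A∈Γ B∈Δ (fwd A⟶C ◅ C≡B) =
    cut (_ , ε , ε) (axiom-∈ A∈Γ (here refl) (A⟶C ◅ ε) ε) (≡R⇒⊢ (here refl) B∈Δ C≡B)
  ≡R⇒⊢ A∈Γ B∈Δ (bwd C⟶A ◅ C≡B) =
    cut (_ , ε , ε) (axiom-∈ A∈Γ (here refl) ε (C⟶A ◅ ε)) (≡R⇒⊢ (here refl) B∈Δ C≡B)

  ⊢⇔linked : ∀ {Γ Δ} → Γ ⊢ Δ ⇔ Linked Γ Δ
  ⊢⇔linked = mk⇔ ⊢⇒linked λ (_ , _ , A∈Γ , B∈Δ , A≡B) → ≡R⇒⊢ A∈Γ B∈Δ A≡B

proposition3 : (S : Signature) (R : Language.RewriteSystem S)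
    (Γ Δ : List (Language.Prop S)) →
    Rewriting._⊢_ R Γ Δ ⇔ (∃₂ λ A B → A ∈ Γ × B ∈ Δ × Rewriting._≡R_ R A B)
proposition3 S R Γ Δ = ⊢⇔linked R
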